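{- Let $(G,k,I_s,I_t)$ be an instance of \textsc{Galactic Token Sliding} with $G$ connected, with planets $A$, to which none of the following rules applies: (R1) two black holes are adjacent; (R3) there is a black hole $u$ and a planet $v\in N(u)$ such that at most one vertex of $N[v]\cap A$ carries a token of $I_s$ or $I_t$; (R5) there is an $A$-geodesic path $P$ of length at least $5k$ such that no vertex of $A\cap N[P]$ carries a token of $I_s$ or $I_t$. Then $G$ has diameter $O(k^2)$, and every connected component $C$ of $G[A]$ is such that $G[C]$ has diameter $O(k^2)$.
   Context: A galactic graph is a simple graph $G$ whose vertex set is partitioned into planets $A(G)$ and black holes $B(G)$. A galactic independent set of size $k$ is a weight function $\omega:V(G)\to\{0,\dots,k\}$ (number of tokens per vertex) with $\sum_v\omega(v)=k$, $\omega(v)\le 1$ for planets, and such that the planets carrying a token form an independent set of $G$. An instance of \textsc{Galactic Token Sliding} is $(G,k,I_s,I_t)$ with $G$ a galactic graph, $k\ge 2$ and $I_s,I_t$ galactic independent sets of size $k$. A path $P$ all of whose vertices are planets is $A$-geodesic if for all $x,y\in V(P)$, the distance between $x$ and $y$ in $G[A]$ equals their distance along $P$. $O(k^2)$ means at most $c\,k^2$ for an absolute constant $c$. -}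

module Defs where

open import Data.Nat using (ℕ; zero; suc; _+_; _*_; _∸_; _≤_; _<_)
open import Data.Fin using (Fin; toℕ; inject₁) renaming (suc to fsuc; zero to fzero)
open import Data.Bool using (Bool; true; false)
open import Data.Product using (Σ; ∃; ∃-syntax; _×_; _,_)
open import Data.Sum using (_⊎_)
open import Data.Unit using (⊤)
open import Relation.Nullary using (¬_)
open import Relation.Binary.PropositionalEquality using (_≡_; _≢_)
open import Function.Definitions using (Injective)

Σfin : ∀ {n} → (Fin n → ℕ) → ℕ
Σfin {zero} f = 0
Σfin {suc n} f = f fzero + Σfin (λ i → f (fsuc i))


record GalacticGraph (n : ℕ) : Set where
  field
    adj       : Fin n → Fin n → Bool
    adj-sym   : ∀ u v → adj u v ≡ adj v u
    adj-irr   : ∀ v → adj v v ≡ false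
    isPlanet  : Fin n → Bool   -- true = planet (in A), false = black hole (in B)

open GalacticGraph public

Planet : ∀ {n} → GalacticGraph n → Fin n → Set
Planet G v = isPlanet G v ≡ true

BlackHole : ∀ {n} → GalacticGraph n → Fin n → Set
BlackHole G v = isPlanet G v ≡ false

Adj : ∀ {n} → GalacticGraph n → Fin n → Fin n → Set
Adj G u v = adj G u v ≡ true

data WalkIn {n} (G : GalacticGraph n) (S : Fin n → Set) : Fin n → Fin n → ℕ → Set where
  here : ∀ {x} → S x → WalkIn G S x x 0
  step : ∀ {x y z l} → S x → Adj G x y → WalkIn G S y z l → WalkIn G S x z (suc l)

Walk : ∀ {n} → GalacticGraph n → Fin n → Fin n → ℕ → Set
Walk G = WalkIn G (λ _ → ⊤)

WalkA : ∀ {n} → GalacticGraph n → Fin n → Fin n → ℕ → Set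
WalkA G = WalkIn G (Planet G)

Connected : ∀ {n} → GalacticGraph n → Set
Connected G = ∀ x y → ∃[ l ] Walk G x y l

Carries : ∀ {n} → (Fin n → ℕ) → Fin n → Set
Carries ω v = 1 ≤ ω v

IsGIS : ∀ {n} → GalacticGraph n → ℕ → (Fin n → ℕ) → Set
IsGIS G k ω =
  Σfin ω ≡ k
  × (∀ v → Planet G v → ω v ≤ 1)
  × (∀ u v → Planet G u → Planet G v → Carries ω u → Carries ω v → ¬ Adj G u v)

R1 : ∀ {n} → GalacticGraph n → Set
R1 G = ∃[ u ] ∃[ v ] (BlackHole G u × BlackHole G v × Adj G u v)

InN[_] : ∀ {n} → GalacticGraph n → Fin n → Fin n → Set
InN[ G ] v w = w ≡ v ⊎ Adj G v w

Weights : ℕ → Set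
Weights n = Fin n → ℕ

TokenST : ∀ {n} → (Fin n → ℕ) → (Fin n → ℕ) → Fin n → Set
TokenST Is It w = Carries Is w ⊎ Carries It w

R3 : ∀ {n} → GalacticGraph n → (Is It : Fin n → ℕ) → Set
R3 G Is It = ∃[ u ] ∃[ v ] (BlackHole G u × Planet G v × Adj G u v ×
  (∀ w₁ w₂ → InN[ G ] v w₁ → Planet G w₁ → TokenST Is It w₁
           → InN[ G ] v w₂ → Planet G w₂ → TokenST Is It w₂ → w₁ ≡ w₂))

record AGeodesicPath {n} (G : GalacticGraph n) (m : ℕ) (P : Fin (suc m) → Fin n) : Set where
  field
    distinct  : Injective _≡_ _≡_ P
    edges     : ∀ (i : Fin m) → Adj G (P (inject₁ i)) (P (fsuc i))
    planets   : ∀ i → Planet G (P i)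
    geodesic  : ∀ i j → toℕ i ≤ toℕ j → ∀ l → l < toℕ j ∸ toℕ i → ¬ WalkA G (P i) (P j) l

R5 : ∀ {n} → GalacticGraph n → ℕ → (Is It : Fin n → ℕ) → Set
R5 {n} G k Is It = ∃[ m ] Σ (Fin (suc m) → Fin n) λ P →
  AGeodesicPath G m P × 5 * k ≤ m ×
  (∀ w → Planet G w → (∃[ i ] InN[ G ] (P i) w) → ¬ TokenST Is It w)

{-# OPTIONS --safe #-}
-- Let p₀ … p_L be a shortest walk between two vertices, in G or in G[A].  Some
-- planet carrying a token lies in the closed neighbourhood of one of p₀ … p_{5k+1}:
-- a black hole p_i with i ≤ 5k is followed by a planet p_{i+1} (no R1) whose closed
-- neighbourhood then holds a token (no R3), and otherwise p₀ … p_{5k} is an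
-- A-geodesic path, next to which (no R5) a token lies.  Since p is shortest, that
-- planet has no neighbour among p_{5k+4}, p_{5k+5}, …, so dropping the first 5k+4
-- vertices strictly decreases the total weight of I_s + I_t on planets near the
-- walk, which is at most 2k.  Hence L < (2k+1)(5k+4) ≤ 21k².
module Submission where

open import Defs
open import Data.Nat using (ℕ; zero; suc; _+_; _*_; _∸_; _≤_; _<_; _≤?_; z≤n; s≤s)
open import Data.Nat.Properties
open import Data.Nat.Induction using (<-rec)
open import Data.Nat.Tactic.RingSolver using (solve-∀)
open import Data.Fin as Fin using (Fin; toℕ)
open import Data.Fin.Properties using (any?; toℕ-injective; toℕ<n; toℕ-inject₁)
open import Data.Bool using (true; false) renaming (_≟_ to _≟ᵇ_)
open import Data.Bool.Properties using (¬-not)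
open import Data.Product using (∃-syntax; _×_; _,_; proj₂; map₁; map₂)
open import Data.Sum using (inj₁; inj₂)
open import Data.Unit using (tt)
open import Data.Empty using (⊥-elim)
open import Level using (0ℓ)
open import Relation.Nullary using (¬_; Dec; yes; no; _×-dec_; _⊎-dec_)
open import Relation.Unary using (Pred; Decidable; _⊆_)
open import Relation.Binary.PropositionalEquality using (_≡_; refl; sym; trans; cong; cong₂; subst)
open import Algebra.Properties.CommutativeSemigroup +-commutativeSemigroup using (interchange)

Σfin-mono : ∀ {n} {f g : Fin n → ℕ} → (∀ v → f v ≤ g v) → Σfin f ≤ Σfin g
Σfin-mono {zero} f≤g = z≤n
Σfin-mono {suc n} f≤g = +-mono-≤ (f≤g Fin.zero) (Σfin-mono (λ v → f≤g (Fin.suc v)))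

Σfin-mono-< : ∀ {n} {f g : Fin n → ℕ} → (∀ v → f v ≤ g v) → ∀ v → f v < g v → Σfin f < Σfin g
Σfin-mono-< f≤g Fin.zero fv<gv = +-mono-<-≤ fv<gv (Σfin-mono (λ v → f≤g (Fin.suc v)))
Σfin-mono-< f≤g (Fin.suc v) fv<gv = +-mono-≤-< (f≤g Fin.zero) (Σfin-mono-< (λ v → f≤g (Fin.suc v)) v fv<gv)

Σfin-+ : ∀ {n} (f g : Fin n → ℕ) → Σfin (λ v → f v + g v) ≡ Σfin f + Σfin g
Σfin-+ {zero} f g = refl
Σfin-+ {suc n} f g =
  trans (cong (f Fin.zero + g Fin.zero +_) (Σfin-+ (λ v → f (Fin.suc v)) (λ v → g (Fin.suc v))))
        (interchange (f Fin.zero) (g Fin.zero) _ _)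

restrict : ∀ {n} {P : Pred (Fin n) 0ℓ} → Decidable P → (Fin n → ℕ) → Fin n → ℕ
restrict P? f v with P? v
... | yes _ = f v
... | no _ = 0

restrict-≤ : ∀ {n} {P : Pred (Fin n) 0ℓ} (P? : Decidable P) f v → restrict P? f v ≤ f v
restrict-≤ P? f v with P? v
... | yes _ = ≤-refl
... | no _ = z≤n

restrict-mono : ∀ {n} {P Q : Pred (Fin n) 0ℓ} (P? : Decidable P) (Q? : Decidable Q) →
                P ⊆ Q → ∀ f v → restrict P? f v ≤ restrict Q? f v
restrict-mono P? Q? P⊆Q f v with P? v | Q? v
... | yes Pv | no ¬Qv = ⊥-elim (¬Qv (P⊆Q Pv))
... | yes _ | yes _ = ≤-refl
... | no _ | _ = z≤n

restrict-< : ∀ {n} {P Q : Pred (Fin n) 0ℓ} (P? : Decidable P) (Q? : Decidable Q) →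
             ∀ f {v} → ¬ P v → Q v → 0 < f v → restrict P? f v < restrict Q? f v
restrict-< P? Q? f {v} ¬Pv Qv 0<fv with P? v | Q? v
... | yes Pv | _ = ⊥-elim (¬Pv Pv)
... | no _ | no ¬Qv = ⊥-elim (¬Qv Qv)
... | no _ | yes _ = 0<fv

detour-< : ∀ {i j l L} → i ≤ j → j ≤ L → l < j ∸ i → i + (l + (L ∸ j)) < L
detour-< {i} {j} {l} {L} i≤j j≤L l<j∸i = begin-strict
  i + (l + (L ∸ j))       <⟨ +-monoʳ-< i (+-monoˡ-< (L ∸ j) l<j∸i) ⟩
  i + ((j ∸ i) + (L ∸ j)) ≡⟨ sym (+-assoc i _ _) ⟩
  i + (j ∸ i) + (L ∸ j)   ≡⟨ cong (_+ (L ∸ j)) (m+[n∸m]≡n i≤j) ⟩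
  j + (L ∸ j)             ≡⟨ m+[n∸m]≡n j≤L ⟩
  L                       ∎
  where open ≤-Reasoning

shift-≤ : ∀ {d i L} → d ≤ L → i ≤ L ∸ d → d + i ≤ L
shift-≤ {d} {i} {L} d≤L i≤L∸d = subst (_≤ L) (+-comm i d) (m≤o∸n⇒m+n≤o i d≤L i≤L∸d)

TokenST? : ∀ {n} (Is It : Weights n) → Decidable (TokenST Is It)
TokenST? Is It w = (1 ≤? Is w) ⊎-dec (1 ≤? It w)

token⇒positive : ∀ {n} {Is It : Weights n} {w} → TokenST Is It w → 0 < Is w + It w
token⇒positive {Is = Is} {It} {w} (inj₁ 1≤Is) = ≤-trans 1≤Is (m≤m+n (Is w) (It w))
token⇒positive {Is = Is} {It} {w} (inj₂ 1≤It) = ≤-trans 1≤It (m≤n+m (It w) (Is w))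

module _ {n} (G : GalacticGraph n) where

  Adj-sym : ∀ {u v} → Adj G u v → Adj G v u
  Adj-sym {u} {v} = trans (adj-sym G v u)

  Adj? : ∀ u v → Dec (Adj G u v)
  Adj? u v = adj G u v ≟ᵇ true

  Planet? : Decidable (Planet G)
  Planet? v = isPlanet G v ≟ᵇ true

  BlackHole? : Decidable (BlackHole G)
  BlackHole? v = isPlanet G v ≟ᵇ false

  InN? : ∀ v → Decidable (InN[ G ] v)
  InN? v w = (w Fin.≟ v) ⊎-dec Adj? v w

  mapWalk : ∀ {S T : Pred (Fin n) 0ℓ} → S ⊆ T → ∀ {x y l} → WalkIn G S x y l → WalkIn G T x y l
  mapWalk S⊆T (here s) = here (S⊆T s)
  mapWalk S⊆T (step s a w) = step (S⊆T s) a (mapWalk S⊆T w)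

  record Geodesic (S : Pred (Fin n) 0ℓ) (p : ℕ → Fin n) (L : ℕ) : Set where
    field
      inside   : ∀ {i} → i ≤ L → S (p i)
      adjacent : ∀ {i} → i < L → Adj G (p i) (p (suc i))
      distance : ∀ {i j} → i ≤ j → j ≤ L → ∀ {l} → WalkIn G S (p i) (p j) l → j ∸ i ≤ l

    ordered-injective : ∀ {i j} → i ≤ j → j ≤ L → p i ≡ p j → i ≡ j
    ordered-injective {i} {j} i≤j j≤L pi≡pj =
      ≤-antisym i≤j (m∸n≡0⇒m≤n (n≤0⇒n≡0 (distance i≤j j≤L stay)))
      where
      stay : WalkIn G S (p i) (p j) 0
      stay = subst (λ z → WalkIn G S (p i) z 0) pi≡pj (here (inside (≤-trans i≤j j≤L)))

    injective : ∀ {i j} → i ≤ L → j ≤ L → p i ≡ p j → i ≡ j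
    injective {i} {j} i≤L j≤L pi≡pj with ≤-total i j
    ... | inj₁ i≤j = ordered-injective i≤j j≤L pi≡pj
    ... | inj₂ j≤i = sym (ordered-injective j≤i i≤L (sym pi≡pj))

  open Geodesic

  module _ {S : Pred (Fin n) 0ℓ} where

    _++ʷ_ : ∀ {x y z l₁ l₂} → WalkIn G S x y l₁ → WalkIn G S y z l₂ → WalkIn G S x z (l₁ + l₂)
    here _ ++ʷ w = w
    step s a w₁ ++ʷ w = step s a (w₁ ++ʷ w)

    walk? : Decidable S → ∀ x y l → Dec (WalkIn G S x y l)
    walk? S? x y zero with x Fin.≟ y | S? x
    ... | yes refl | yes s = yes (here s)
    ... | yes refl | no ¬s = no λ { (here s) → ¬s s }
    ... | no x≢y | _ = no λ { (here _) → x≢y refl }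
    walk? S? x y (suc l) with S? x | any? (λ z → Adj? x z ×-dec walk? S? z y l)
    ... | yes s | yes (z , a , w) = yes (step s a w)
    ... | no ¬s | _ = no λ { (step s _ _) → ¬s s }
    ... | yes _ | no ¬w = no λ { (step _ a w) → ¬w (_ , a , w) }

    NoShorterWalk : Fin n → Fin n → ℕ → Set
    NoShorterWalk x y L = ∀ {l} → l < L → ¬ WalkIn G S x y l

    shortest-walk : Decidable S → ∀ {x y l} → WalkIn G S x y l →
                    ∃[ L ] (WalkIn G S x y L × NoShorterWalk x y L)
    shortest-walk S? {x} {y} = <-rec Shortenable shorten _
      where
      Shortenable : ℕ → Set
      Shortenable l = WalkIn G S x y l → ∃[ L ] (WalkIn G S x y L × NoShorterWalk x y L)
      shorten : ∀ l → (∀ {l′} → l′ < l → Shortenable l′) → Shortenable l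
      shorten l rec w with anyUpTo? (walk? S? x y) l
      ... | yes (l′ , l′<l , w′) = rec l′<l w′
      ... | no none = l , w , λ l′<l w′ → none (_ , l′<l , w′)

    -- Positions past the end of the walk give a junk vertex; they are never used.
    vertex : ∀ {x y l} → WalkIn G S x y l → ℕ → Fin n
    vertex {x} w zero = x
    vertex {x} (here _) (suc i) = x
    vertex (step _ _ w) (suc i) = vertex w i

    prefix : ∀ {x y l} (w : WalkIn G S x y l) {i} → i ≤ l → WalkIn G S x (vertex w i) i
    prefix (here s) z≤n = here s
    prefix (step s _ _) z≤n = here s
    prefix (step s a w) (s≤s i≤l) = step s a (prefix w i≤l)

    suffix : ∀ {x y l} (w : WalkIn G S x y l) {j} → j ≤ l → WalkIn G S (vertex w j) y (l ∸ j)
    suffix w z≤n = w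
    suffix (step _ _ w) (s≤s j≤l) = suffix w j≤l

    vertex-inside : ∀ {x y l} (w : WalkIn G S x y l) {i} → i ≤ l → S (vertex w i)
    vertex-inside (here s) z≤n = s
    vertex-inside (step s _ _) z≤n = s
    vertex-inside (step _ _ w) (s≤s i≤l) = vertex-inside w i≤l

    vertex-adjacent : ∀ {x y l} (w : WalkIn G S x y l) {i} → i < l → Adj G (vertex w i) (vertex w (suc i))
    vertex-adjacent (step _ a _) (s≤s z≤n) = a
    vertex-adjacent (step _ _ w) (s≤s (s≤s i<l)) = vertex-adjacent w (s≤s i<l)

    shortest⇒geodesic : ∀ {x y L} (w : WalkIn G S x y L) → NoShorterWalk x y L → Geodesic S (vertex w) L
    inside (shortest⇒geodesic w _) = vertex-inside w
    adjacent (shortest⇒geodesic w _) = vertex-adjacent w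
    distance (shortest⇒geodesic w shortest) i≤j j≤L c = ≮⇒≥ λ l<j∸i →
      shortest (detour-< i≤j j≤L l<j∸i) (prefix w (≤-trans i≤j j≤L) ++ʷ (c ++ʷ suffix w j≤L))

  drop-geodesic : ∀ {S p L} d → d ≤ L → Geodesic S p L → Geodesic S (λ i → p (d + i)) (L ∸ d)
  inside (drop-geodesic d d≤L γ) i≤L∸d = inside γ (shift-≤ d≤L i≤L∸d)
  adjacent (drop-geodesic {p = p} {L} d d≤L γ) {i} i<L∸d =
    subst (λ t → Adj G (p (d + i)) (p t)) (sym (+-suc d i))
      (adjacent γ (subst (_≤ L) (+-suc d i) (shift-≤ d≤L i<L∸d)))
  distance (drop-geodesic d d≤L γ) {i} {j} i≤j j≤L∸d {l} c =
    subst (_≤ l) ([m+n]∸[m+o]≡n∸o d j i) (distance γ (+-monoʳ-≤ d i≤j) (shift-≤ d≤L j≤L∸d) c)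

  geodesic⇒AGeodesicPath : ∀ {S p L m} → Planet G ⊆ S → Geodesic S p L → m ≤ L →
                           (∀ {i} → i ≤ m → Planet G (p i)) → AGeodesicPath G m (λ i → p (toℕ i))
  geodesic⇒AGeodesicPath {p = p} {L} {m} planet⊆S γ m≤L planet = record
    { distinct = λ {i} {j} pi≡pj → toℕ-injective (injective γ (on-path i) (on-path j) pi≡pj)
    ; edges    = λ i → subst (λ t → Adj G (p t) (p (suc (toℕ i)))) (sym (toℕ-inject₁ i))
                             (adjacent γ (<-≤-trans (toℕ<n i) m≤L))
    ; planets  = λ i → planet (≤-pred (toℕ<n i))
    ; geodesic = λ i j i≤j l l<j∸i c → <⇒≱ l<j∸i (distance γ i≤j (on-path j) (mapWalk planet⊆S c))
    }
    where
    on-path : (i : Fin (suc m)) → toℕ i ≤ L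
    on-path i = ≤-trans (≤-pred (toℕ<n i)) m≤L

  Near : (ℕ → Fin n) → ℕ → Pred (Fin n) 0ℓ
  Near p b v = Planet G v × ∃[ i ] (i < b × InN[ G ] (p i) v)

  Near? : ∀ p b → Decidable (Near p b)
  Near? p b v = Planet? v ×-dec anyUpTo? (λ i → InN? (p i) v) b

  Near-mono : ∀ {p b b′} → b ≤ b′ → Near p b ⊆ Near p b′
  Near-mono b≤b′ (pv , i , i<b , near) = pv , i , <-≤-trans i<b b≤b′ , near

  ¬R1⇒planet : ¬ R1 G → ∀ {u v} → BlackHole G u → Adj G u v → Planet G v
  ¬R1⇒planet ¬r1 {u} {v} black uv = ¬-not λ black′ → ¬r1 (u , v , black , black′ , uv)

  common-neighbour-walk : ∀ {S : Pred (Fin n) 0ℓ} {u v w} → S u → S v → S w →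
                          InN[ G ] u w → InN[ G ] v w → ∃[ l ] (l ≤ 2 × WalkIn G S u v l)
  common-neighbour-walk su sv sw (inj₁ refl) (inj₁ refl) = 0 , z≤n , here su
  common-neighbour-walk su sv sw (inj₁ refl) (inj₂ vw) = 1 , s≤s z≤n , step su (Adj-sym vw) (here sv)
  common-neighbour-walk su sv sw (inj₂ uw) (inj₁ refl) = 1 , s≤s z≤n , step su uw (here sv)
  common-neighbour-walk su sv sw (inj₂ uw) (inj₂ vw) = 2 , ≤-refl , step su uw (step sw (Adj-sym vw) (here sv))

  common-neighbour-close : ∀ {S p L i j w} → Planet G ⊆ S → Geodesic S p L → i ≤ j → j ≤ L →
                           Planet G w → InN[ G ] (p i) w → InN[ G ] (p j) w → j ≤ 2 + i
  common-neighbour-close {i = i} {j} planet⊆S γ i≤j j≤L pw near-i near-j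
    with common-neighbour-walk (inside γ (≤-trans i≤j j≤L)) (inside γ j≤L) (planet⊆S pw) near-i near-j
  ... | _ , l≤2 , c = begin
    j           ≤⟨ m≤n+m∸n j i ⟩
    i + (j ∸ i) ≤⟨ +-monoʳ-≤ i (≤-trans (distance γ i≤j j≤L c) l≤2) ⟩
    i + 2       ≡⟨ +-comm i 2 ⟩
    2 + i       ∎
    where open ≤-Reasoning

  module _ {Is It : Weights n} where

    ¬R3⇒token-near : ¬ R3 G Is It → ∀ {u v} → BlackHole G u → Planet G v → Adj G u v →
                     ∃[ w ] (Planet G w × TokenST Is It w × InN[ G ] v w)
    ¬R3⇒token-near ¬r3 {u} {v} black pv uv with any? (λ w → Planet? w ×-dec TokenST? Is It w ×-dec InN? v w)
    ... | yes found = found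
    ... | no none = ⊥-elim (¬r3 (u , v , black , pv , uv , λ w₁ _ near₁ planet₁ token₁ _ _ _ →
                                   ⊥-elim (none (w₁ , planet₁ , token₁ , near₁))))

    ¬R5⇒token-near : ∀ {k m P} → ¬ R5 G k Is It → AGeodesicPath G m P → 5 * k ≤ m →
                     ∃[ w ] (Planet G w × TokenST Is It w × ∃[ i ] InN[ G ] (P i) w)
    ¬R5⇒token-near {m = m} {P} ¬r5 γ 5k≤m
      with any? (λ w → Planet? w ×-dec TokenST? Is It w ×-dec any? (λ i → InN? (P i) w))
    ... | yes found = found
    ... | no none = ⊥-elim (¬r5 (m , P , γ , 5k≤m , λ w pw near token → none (w , pw , token , near)))

    potential : (ℕ → Fin n) → ℕ → ℕ
    potential p b = Σfin (restrict (Near? p b) (λ v → Is v + It v))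

    potential-≤ : ∀ p b → potential p b ≤ Σfin Is + Σfin It
    potential-≤ p b = ≤-trans (Σfin-mono (restrict-≤ (Near? p b) _)) (≤-reflexive (Σfin-+ Is It))

    potential-< : ∀ {p b q b′ w} → Near q b′ ⊆ Near p b →
                  Near p b w → ¬ Near q b′ w → TokenST Is It w → potential q b′ < potential p b
    potential-< {p} {b} {q} {b′} {w} near-drop⇒near near-p far token =
      Σfin-mono-< (restrict-mono (Near? q b′) (Near? p b) near-drop⇒near _) w
        (restrict-< (Near? q b′) (Near? p b) _ far near-p (token⇒positive {Is = Is} {It} token))

    module _ {k} (¬r1 : ¬ R1 G) (¬r3 : ¬ R3 G Is It) (¬r5 : ¬ R5 G k Is It)
             {S : Pred (Fin n) 0ℓ} (planet⊆S : Planet G ⊆ S) where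

      token-after-black-hole : ∀ {p L i} → Geodesic S p L → i < L → BlackHole G (p i) →
                               ∃[ w ] (Near p (2 + i) w × TokenST Is It w)
      token-after-black-hole {p} {i = i} γ i<L black =
        let w , pw , token , near = ¬R3⇒token-near ¬r3 black (¬R1⇒planet ¬r1 black edge) edge
        in w , (pw , suc i , ≤-refl , near) , token
        where
        edge : Adj G (p i) (p (suc i))
        edge = adjacent γ i<L

      token-near-planets : ∀ {p L} → Geodesic S p L → 5 * k ≤ L →
                           (∀ {i} → i ≤ 5 * k → Planet G (p i)) →
                           ∃[ w ] (Near p (suc (5 * k)) w × TokenST Is It w)
      token-near-planets γ 5k≤L planet =
        let w , pw , token , i , near =
              ¬R5⇒token-near {k} ¬r5 (geodesic⇒AGeodesicPath planet⊆S γ 5k≤L planet) ≤-refl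
        in w , (pw , toℕ i , toℕ<n i , near) , token

      token-near-geodesic : ∀ {p L} → Geodesic S p L → 5 * k < L →
                            ∃[ w ] (Near p (2 + 5 * k) w × TokenST Is It w)
      token-near-geodesic {p} γ 5k<L with anyUpTo? (λ i → BlackHole? (p i)) (suc (5 * k))
      ... | yes (i , i<1+5k , black) =
        map₂ (map₁ (Near-mono (s≤s i<1+5k))) (token-after-black-hole γ (≤-trans i<1+5k 5k<L) black)
      ... | no no-black =
        map₂ (map₁ (Near-mono (n≤1+n _))) (token-near-planets γ (<⇒≤ 5k<L)
          λ {i} i≤5k → ¬-not λ black → no-black (i , s≤s i≤5k , black))

      stride : ℕ
      stride = 4 + 5 * k

      potential-drop-< : ∀ {p L} → Geodesic S p L → stride ≤ L →
                         potential (λ i → p (stride + i)) (suc (L ∸ stride)) < potential p (suc L)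
      potential-drop-< {p} {L} γ stride≤L with token-near-geodesic γ (≤-trans (m≤n+m _ 3) stride≤L)
      ... | w , (pw , j , j<2+5k , near-j) , token = potential-< near-drop⇒near (pw , j , j<1+L , near-j) far token
        where
        near-drop⇒near : Near (λ i → p (stride + i)) (suc (L ∸ stride)) ⊆ Near p (suc L)
        near-drop⇒near (pv , i , s≤s i≤L∸stride , near) =
          pv , stride + i , s≤s (shift-≤ stride≤L i≤L∸stride) , near
        j<1+L : j < suc L
        j<1+L = m<n⇒m<1+n (<-≤-trans j<2+5k (≤-trans (m≤n+m _ 2) stride≤L))
        far : ¬ Near (λ i → p (stride + i)) (suc (L ∸ stride)) w
        far (_ , i , s≤s i≤L∸stride , near-i) =
          <⇒≱ 2+j<stride+i (common-neighbour-close planet⊆S γ (≤-trans (m≤n+m j 2) (<⇒≤ 2+j<stride+i))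
                                                   (shift-≤ stride≤L i≤L∸stride) pw near-j near-i)
          where
          2+j<stride+i : 2 + j < stride + i
          2+j<stride+i = <-≤-trans (+-monoʳ-< 2 j<2+5k) (m≤m+n stride i)

      geodesic-length : ∀ m {p L} → Geodesic S p L → potential p (suc L) < m → L < m * stride
      geodesic-length zero _ potential<0 = ⊥-elim (n≮0 potential<0)
      geodesic-length (suc m) {L = L} γ potential≤m with stride ≤? L
      ... | no stride≰L = <-≤-trans (≰⇒> stride≰L) (m≤m+n stride (m * stride))
      ... | yes stride≤L = begin-strict
        L                     ≡⟨ sym (m+[n∸m]≡n stride≤L) ⟩
        stride + (L ∸ stride) <⟨ +-monoʳ-< stride rest ⟩
        stride + m * stride   ∎
        where
        open ≤-Reasoning
        rest : L ∸ stride < m * stride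
        rest = geodesic-length m (drop-geodesic stride stride≤L γ)
                 (<-≤-trans (potential-drop-< γ stride≤L) (≤-pred potential≤m))

tokens×stride≤21k² : ∀ k → 2 ≤ k → suc (k + k) * (4 + 5 * k) ≤ 21 * (k * k)
tokens×stride≤21k² k 2≤k = begin
  suc (k + k) * (4 + 5 * k)       ≤⟨ *-mono-≤ (+-monoˡ-≤ (k + k) 1≤k)
                                              (+-monoˡ-≤ (5 * k) (*-monoʳ-≤ 2 2≤k)) ⟩
  (k + (k + k)) * (2 * k + 5 * k) ≡⟨ expand k ⟩
  21 * (k * k)                    ∎
  where
  open ≤-Reasoning
  expand : ∀ k → (k + (k + k)) * (2 * k + 5 * k) ≡ 21 * (k * k)
  expand = solve-∀
  1≤k : 1 ≤ k
  1≤k = ≤-trans (s≤s z≤n) 2≤k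

shortest-walk-bound : ∀ {n} (G : GalacticGraph n) k (Is It : Weights n) →
                      2 ≤ k → Σfin Is ≡ k → Σfin It ≡ k →
                      ¬ R1 G → ¬ R3 G Is It → ¬ R5 G k Is It →
                      ∀ {S} → Decidable S → Planet G ⊆ S →
                      ∀ {x y l} → WalkIn G S x y l → ∃[ L ] (L ≤ 21 * (k * k) × WalkIn G S x y L)
shortest-walk-bound G k Is It 2≤k ΣIs≡k ΣIt≡k ¬r1 ¬r3 ¬r5 S? planet⊆S w with shortest-walk G S? w
... | L , shortest , no-shorter = L , ≤-trans (<⇒≤ L<) (tokens×stride≤21k² k 2≤k) , shortest
  where
  potential≤2k : potential G {Is} {It} (vertex G shortest) (suc L) ≤ k + k
  potential≤2k = ≤-trans (potential-≤ G _ _) (≤-reflexive (cong₂ _+_ ΣIs≡k ΣIt≡k))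
  L< : L < suc (k + k) * (4 + 5 * k)
  L< = geodesic-length G {k = k} ¬r1 ¬r3 ¬r5 planet⊆S (suc (k + k))
         (shortest⇒geodesic G shortest no-shorter) (s≤s potential≤2k)

corollary14 : ∃[ c ] (∀ {n} (G : GalacticGraph n) (k : ℕ) (Is It : Weights n)
    → 2 ≤ k → IsGIS G k Is → IsGIS G k It → Connected G
    → ¬ R1 G → ¬ R3 G Is It → ¬ R5 G k Is It
    → (∀ x y → ∃[ l ] (l ≤ c * (k * k) × Walk G x y l))
      × (∀ x y → ∃[ l ] WalkA G x y l → ∃[ l ] (l ≤ c * (k * k) × WalkA G x y l)))
corollary14 = 21 , λ G k Is It 2≤k (ΣIs≡k , _) (ΣIt≡k , _) connected ¬r1 ¬r3 ¬r5 →
  let bound = shortest-walk-bound G k Is It 2≤k ΣIs≡k ΣIt≡k ¬r1 ¬r3 ¬r5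
  in (λ x y → bound (λ _ → yes tt) (λ _ → tt) (proj₂ (connected x y)))
   , (λ x y (_ , w) → bound (Planet? G) (λ planet → planet) w)
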